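{- Let $n\geq 3$. Then $D(P_{n,1})=\lfloor n/2\rfloor+1$.
   Context: For positive integers $n,k$ with $2\le 2k<n$, the generalised Petersen graph $P_{n,k}$ has vertex set $\{u_i,v_i: i\in\{0,\dots,n-1\}\}$ and edge set $\{u_iu_{i+1}, v_iv_{i+k}, u_iv_i : i\in\{0,\dots,n-1\}\}$, indices modulo $n$ (so $P_{n,1}$ is the $n$-gonal prism). A signed graph $(G,E_-)$ is a simple graph $G$ with a set $E_-\subseteq E(G)$ of negative edges; other edges are positive. A cycle is positive if the product of its edge signs is positive; a signed graph is balanced if every cycle is positive. The frustration index $l(G,E_-)$ is the minimum number of edges whose deletion leaves a balanced signed graph, and the maximum frustration is $D(G)=\max_{E_-\subseteq E(G)} l(G,E_-)$. -}

module Defs where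

open import Data.Nat using (ℕ; zero; suc; _+_; _*_; _≤_; _%_)
open import Data.Nat.DivMod using (_mod_)
open import Data.Fin using (Fin; toℕ; _↑ˡ_; _↑ʳ_; remQuot)
open import Data.Fin.Subset using (Subset; _∈_; _∉_; ∣_∣)
open import Data.Vec using (lookup)
open import Data.Bool using (true; false; if_then_else_)
open import Data.List using (allFin; map)
open import Data.Nat.ListAction using (sum)
open import Data.Product using (_×_; _,_; Σ; ∃)
open import Data.Sum using (_⊎_)
open import Function using (_∘_)
open import Function.Definitions using (Injective)
open import Relation.Binary.PropositionalEquality using (_≡_)

-- Finite simple graphs with labelled edges.
-- Vertices are Fin V, edges are Fin E, each edge has two endpoints.
-- (Simplicity of the concrete graph below is evident from construction.)

record Graph : Set where
  field
    V    : ℕ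
    E    : ℕ
    ends : Fin E → Fin V × Fin V

open Graph public

Joins : (G : Graph) → Fin (E G) → Fin (V G) → Fin (V G) → Set
Joins G e a b = (ends G e ≡ (a , b)) ⊎ (ends G e ≡ (b , a))

nextC : ∀ {k} → Fin (3 + k) → Fin (3 + k)
nextC {k} j = suc (toℕ j) mod (3 + k)

record Cycle (G : Graph) : Set where
  field
    k     : ℕ
    vert  : Fin (3 + k) → Fin (V G)
    edge  : Fin (3 + k) → Fin (E G)
    vinj  : Injective _≡_ _≡_ vert
    joins : ∀ j → Joins G (edge j) (vert j) (vert (nextC j))

open Cycle public

-- number of negative edges on a cycle (with respect to signature Eₘ)
negCount : {G : Graph} → Subset (E G) → Cycle G → ℕ
negCount Eₘ c =
  sum (map (λ j → if lookup Eₘ (edge c j) then 1 else 0) (allFin (3 + k c)))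

-- a cycle is positive if the product of its signs is +, i.e. it has an
-- even number of negative edges
Positive : {G : Graph} → Subset (E G) → Cycle G → Set
Positive Eₘ c = negCount Eₘ c % 2 ≡ 0

BalancedAfterDeleting : (G : Graph) → Subset (E G) → Subset (E G) → Set
BalancedAfterDeleting G Eₘ D =
  (c : Cycle G) → (∀ j → edge c j ∉ D) → Positive Eₘ c

IsFrustrationIndex : (G : Graph) → Subset (E G) → ℕ → Set
IsFrustrationIndex G Eₘ m =
  (Σ (Subset (E G)) λ D → ∣ D ∣ ≡ m × BalancedAfterDeleting G Eₘ D)
  × (∀ D → BalancedAfterDeleting G Eₘ D → m ≤ ∣ D ∣)

IsMaxFrustration : Graph → ℕ → Set
IsMaxFrustration G m =
  (Σ (Subset (E G)) λ Eₘ → IsFrustrationIndex G Eₘ m)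
  × (∀ Eₘ l → IsFrustrationIndex G Eₘ l → l ≤ m)

-- The prism P_{n,1}.  Vertices: u_i = i ↑ˡ n, v_i = n ↑ʳ i in
-- Fin (n + n).  Edges: Fin (3 * n) ≅ Fin 3 × Fin n via remQuot:
--   (0 , i) ↦ u_i u_{i+1},  (1 , i) ↦ v_i v_{i+1},  (2 , i) ↦ u_i v_i.

sucMod : ∀ {n} → Fin n → Fin n
sucMod {suc m} i = suc (toℕ i) mod (suc m)

uV vV : ∀ {n} → Fin n → Fin (n + n)
uV {n} i = i ↑ˡ n
vV {n} i = n ↑ʳ i

prismEnds : ∀ {n} → Fin 3 × Fin n → Fin (n + n) × Fin (n + n)
prismEnds (Fin.zero , i) = uV i , uV (sucMod i)
prismEnds (Fin.suc Fin.zero , i) = vV i , vV (sucMod i)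
prismEnds (Fin.suc (Fin.suc Fin.zero) , i) = uV i , vV i

Prism : ℕ → Graph
Prism n = record
  { V = n + n
  ; E = 3 * n
  ; ends = prismEnds ∘ remQuot n
  }

module Submission where

-- Both bounds
-- use switchings s : V → Bool: deleting the edges whose sign disagrees with
-- s on their endpoints (the frustrated edges) balances the graph, because
-- around every surviving cycle the signs telescope to an even parity.
--
-- Upper bound (module UpperBound): switch the outer and the inner n-cycle
-- along the prefix parities of their signs, and complement the inner cycle
-- if that leaves fewer negative spokes.  This costs one edge per negative
-- cycle plus at most n/2 spokes.  When both cycles are negative and some
-- spoke m is negative, cutting the two cycles on either side of m makes that
-- spoke positive, keeping the cost at most n/2 + 1.
--
-- Lower bound (module LowerBound): for the signature in which u_0 u_1 and
-- the inner edges v_i v_{i+1} (i ≠ 0) are negative, all n squares, the outer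
-- cycle and, for even n, the inner cycle are negative.  A balancing set
-- meets each of them, and counting the incidences gives ⌊n/2⌋ + 1 edges.

open import Defs
open import Algebra.Bundles using (CommutativeMonoid; CommutativeRing)
import Algebra.Properties.CommutativeMonoid.Sum as MonoidSum
open import Data.Bool using (Bool; true; false; not; _xor_; if_then_else_)
open import Data.Bool.Properties
  using (_≟_; ¬-not; xor-∧-commutativeRing; xor-comm; xor-same; xor-assoc; xor-identityʳ)
open import Data.Fin using (Fin; zero; suc; toℕ; fromℕ; inject₁; _↑ˡ_; _↑ʳ_; splitAt; combine; remQuot)
open import Data.Fin.Patterns using (0F; 1F; 2F; 3F)
open import Data.Fin.Properties
  using (any?; toℕ-injective; toℕ-fromℕ<; toℕ-fromℕ; toℕ-inject₁; toℕ<n; toℕ-↑ˡ; toℕ-↑ʳ;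
         ↑ˡ-injective; ↑ʳ-injective; splitAt-↑ˡ; splitAt-↑ʳ; remQuot-combine)
open import Data.Fin.Subset using (Subset; _∉_; ∣_∣)
open import Data.List using (tabulate)
open import Data.List.Properties using (map-tabulate)
open import Data.Maybe using (Maybe; just; nothing)
open import Data.Nat using (ℕ; zero; suc; _+_; _*_; _≤_; _/_; _%_; _<ᵇ_; _≡ᵇ_; s≤s; z≤n)
open import Data.Nat.DivMod
  using (m≡m%n+[m/n]*n; %-distribˡ-+; m<n⇒m%n≡m; n%n≡0; m%n<n; m*n/n≡m; /-monoˡ-≤)
open import Data.Nat.ListAction using (sum)
open import Data.Nat.Properties
  using (+-0-commutativeMonoid; +-assoc; +-comm; +-suc; +-identityʳ; +-mono-≤; +-monoˡ-≤; +-monoʳ-≤;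
         *-cancelʳ-≤; ≤-refl; ≤-reflexive; ≤-trans; ≤-antisym; ≤-total; ≤-pred; <⇒≢; m≤m+n; m≤n+m;
         n≢0⇒n>0; m≤n⇒m<n∨m≡n; 1+n≢n; suc-injective; module ≤-Reasoning)
import Data.Nat.Tactic.RingSolver as ℕ-Solver
open import Data.Product using (Σ; ∃; _×_; _,_; proj₁; proj₂; map₂)
open import Data.Sum using (_⊎_; inj₁; inj₂; [_,_]′)
open import Data.Vec using (lookup; _∷_; [])
import Data.Vec as Vec
open import Data.Vec.Properties using (lookup∘tabulate; lookup⇒[]=; []=⇒lookup)
open import Function using (_∘_)
open import Function.Definitions using (Injective)
open import Level using (0ℓ)
open import Relation.Binary.PropositionalEquality
  using (_≡_; _≢_; refl; sym; trans; cong; cong₂; subst; subst₂; module ≡-Reasoning)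
open import Relation.Nullary using (¬_; contradiction; yes; no)
open import Tactic.RingSolver using (solve-∀)
open import Tactic.RingSolver.Core.AlmostCommutativeRing using (AlmostCommutativeRing; fromCommutativeRing)

⊕-commutativeMonoid : CommutativeMonoid 0ℓ 0ℓ
⊕-commutativeMonoid = CommutativeRing.+-commutativeMonoid xor-∧-commutativeRing

module ℕ-Sum = MonoidSum +-0-commutativeMonoid
module ⊕-Sum = MonoidSum ⊕-commutativeMonoid

∑ : ∀ {n} → (Fin n → ℕ) → ℕ
∑ = ℕ-Sum.sum

parity : ∀ {n} → (Fin n → Bool) → Bool
parity = ⊕-Sum.sum

⊕-ring : AlmostCommutativeRing 0ℓ 0ℓ
⊕-ring = fromCommutativeRing xor-∧-commutativeRing isFalse
  where
  isFalse : ∀ b → Maybe (false ≡ b)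
  isFalse false = just refl
  isFalse true = nothing

bit : Bool → ℕ
bit b = if b then 1 else 0

xor≡false⇒≡ : ∀ x y → x xor y ≡ false → x ≡ y
xor≡false⇒≡ false false _ = refl
xor≡false⇒≡ false true ()
xor≡false⇒≡ true false ()
xor≡false⇒≡ true true _ = refl

term≤∑ : ∀ {n} (f : Fin n → ℕ) (j : Fin n) → f j ≤ ∑ f
term≤∑ f zero = m≤m+n (f zero) _
term≤∑ f (suc j) = ≤-trans (term≤∑ (f ∘ suc) j) (m≤n+m _ (f zero))

∑-mono : ∀ {n} {f g : Fin n → ℕ} → (∀ i → f i ≤ g i) → ∑ f ≤ ∑ g
∑-mono {zero} _ = z≤n
∑-mono {suc n} f≤g = +-mono-≤ (f≤g zero) (∑-mono (f≤g ∘ suc))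

∑-ones : ∀ n → ∑ {n} (λ _ → 1) ≡ n
∑-ones zero = refl
∑-ones (suc n) = cong suc (∑-ones n)

sum-tabulate : ∀ {n} (f : Fin n → ℕ) → sum (tabulate f) ≡ ∑ f
sum-tabulate {zero} f = refl
sum-tabulate {suc n} f = cong (f zero +_) (sum-tabulate (f ∘ suc))

∣∣≡∑ : ∀ {n} (p : Subset n) → ∣ p ∣ ≡ ∑ (bit ∘ lookup p)
∣∣≡∑ [] = refl
∣∣≡∑ (true ∷ p) = cong suc (∣∣≡∑ p)
∣∣≡∑ (false ∷ p) = ∣∣≡∑ p

∑bit-mod-2 : ∀ {n} (f : Fin n → Bool) → ∑ (bit ∘ f) % 2 ≡ bit (parity f)
∑bit-mod-2 {zero} f = refl
∑bit-mod-2 {suc n} f = begin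
  (bit (f zero) + ∑ (bit ∘ f ∘ suc)) % 2
    ≡⟨ %-distribˡ-+ (bit (f zero)) (∑ (bit ∘ f ∘ suc)) 2 ⟩
  (bit (f zero) % 2 + ∑ (bit ∘ f ∘ suc) % 2) % 2
    ≡⟨ cong (λ m → (bit (f zero) % 2 + m) % 2) (∑bit-mod-2 (f ∘ suc)) ⟩
  (bit (f zero) % 2 + bit (parity (f ∘ suc))) % 2
    ≡⟨ bit-xor (f zero) (parity (f ∘ suc)) ⟩
  bit (f zero xor parity (f ∘ suc)) ∎
  where
  open ≡-Reasoning
  bit-xor : ∀ a b → (bit a % 2 + bit b) % 2 ≡ bit (a xor b)
  bit-xor false false = refl
  bit-xor false true = refl
  bit-xor true false = refl
  bit-xor true true = refl

parity-ones : ∀ m → bit (parity {m} (λ _ → true)) ≡ m % 2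
parity-ones m = trans (sym (∑bit-mod-2 {m} (λ _ → true))) (cong (_% 2) (∑-ones m))

∑bit-complement : ∀ {n} (f : Fin n → Bool) → ∑ (bit ∘ f) + ∑ (bit ∘ not ∘ f) ≡ n
∑bit-complement {zero} f = refl
∑bit-complement {suc n} f with f zero
... | true = cong suc (∑bit-complement (f ∘ suc))
... | false = trans (+-suc _ _) (cong suc (∑bit-complement (f ∘ suc)))

∑bit-none : ∀ {n} (f : Fin n → Bool) → ¬ (∃ λ m → f m ≡ true) → ∑ (bit ∘ f) ≡ 0
∑bit-none {n} f none =
  trans (ℕ-Sum.sum-cong-≗ (λ m → cong bit (¬-not λ fm → none (m , fm)))) (ℕ-Sum.sum-replicate-zero n)

∑bit-flip : ∀ {n} (f : Fin n → Bool) (m : Fin n) → f m ≡ true →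
            ∑ (λ i → bit (f i xor (toℕ i ≡ᵇ toℕ m))) + 1 ≡ ∑ (bit ∘ f)
∑bit-flip f zero fm rewrite fm =
  trans (+-comm _ 1) (cong suc (ℕ-Sum.sum-cong-≗ (cong bit ∘ xor-identityʳ ∘ f ∘ suc)))
∑bit-flip f (suc m) fm with f zero | ∑bit-flip (f ∘ suc) m fm
... | true | flipped = cong suc flipped
... | false | flipped = flipped

∑-↑ : ∀ m {n} (f : Fin (m + n) → ℕ) → ∑ f ≡ ∑ (f ∘ (_↑ˡ n)) + ∑ (f ∘ (m ↑ʳ_))
∑-↑ zero f = refl
∑-↑ (suc m) f = trans (cong (f zero +_) (∑-↑ m (f ∘ suc))) (sym (+-assoc (f zero) _ _))

∑-combine : ∀ m n (f : Fin (m * n) → ℕ) → ∑ f ≡ ∑ {m} (λ r → ∑ {n} (λ i → f (combine r i)))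
∑-combine zero n f = refl
∑-combine (suc m) n f = trans (∑-↑ n f) (cong (∑ (f ∘ (_↑ˡ m * n)) +_) (∑-combine m n (f ∘ (n ↑ʳ_))))

toℕ-sucMod : ∀ {p} (i : Fin (suc p)) → toℕ (sucMod i) ≡ suc (toℕ i) % suc p
toℕ-sucMod {p} i = toℕ-fromℕ< (m%n<n (suc (toℕ i)) (suc p))

sucMod-inject₁ : ∀ {p} (j : Fin p) → sucMod (inject₁ j) ≡ suc j
sucMod-inject₁ {p} j = toℕ-injective (begin
  toℕ (sucMod (inject₁ j))     ≡⟨ toℕ-sucMod (inject₁ j) ⟩
  suc (toℕ (inject₁ j)) % suc p ≡⟨ cong (λ m → suc m % suc p) (toℕ-inject₁ j) ⟩
  suc (toℕ j) % suc p           ≡⟨ m<n⇒m%n≡m (s≤s (toℕ<n j)) ⟩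
  suc (toℕ j)                   ∎)
  where open ≡-Reasoning

sucMod-fromℕ : ∀ p → sucMod (fromℕ p) ≡ zero
sucMod-fromℕ p = toℕ-injective (begin
  toℕ (sucMod (fromℕ p))     ≡⟨ toℕ-sucMod (fromℕ p) ⟩
  suc (toℕ (fromℕ p)) % suc p ≡⟨ cong (λ m → suc m % suc p) (toℕ-fromℕ p) ⟩
  suc p % suc p               ≡⟨ n%n≡0 (suc p) ⟩
  0                           ∎)
  where open ≡-Reasoning

sucMod-≢ : ∀ {p} → 1 ≤ p → (i : Fin (suc p)) → sucMod i ≢ i
sucMod-≢ {p} 1≤p i fixed with m≤n⇒m<n∨m≡n (toℕ<n i)
... | inj₁ below = 1+n≢n (begin
  suc (toℕ i)         ≡⟨ m<n⇒m%n≡m below ⟨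
  suc (toℕ i) % suc p ≡⟨ toℕ-sucMod i ⟨
  toℕ (sucMod i)      ≡⟨ cong toℕ fixed ⟩
  toℕ i               ∎)
  where open ≡-Reasoning
... | inj₂ last = contradiction (subst (1 ≤_) (trans (sym (suc-injective last)) i≡0) 1≤p) λ ()
  where
  open ≡-Reasoning
  i≡0 : toℕ i ≡ 0
  i≡0 = begin
    toℕ i               ≡⟨ cong toℕ fixed ⟨
    toℕ (sucMod i)      ≡⟨ toℕ-sucMod i ⟩
    suc (toℕ i) % suc p ≡⟨ cong (_% suc p) last ⟩
    suc p % suc p       ≡⟨ n%n≡0 (suc p) ⟩
    0                   ∎

module _ {c ℓ} (M : CommutativeMonoid c ℓ) where
  open CommutativeMonoid M
  open MonoidSum M using (sum-init-last; sum-cong-≗) renaming (sum to ∑ᴹ)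
  open import Relation.Binary.Reasoning.Setoid setoid

  sum-rotate : ∀ {p} (f : Fin (suc p) → Carrier) → ∑ᴹ (f ∘ sucMod) ≈ ∑ᴹ f
  sum-rotate {p} f = begin
    ∑ᴹ (f ∘ sucMod)                                      ≈⟨ sum-init-last (f ∘ sucMod) ⟩
    ∑ᴹ (f ∘ sucMod ∘ inject₁) ∙ f (sucMod (fromℕ p))
      ≡⟨ cong₂ _∙_ (sum-cong-≗ (cong f ∘ sucMod-inject₁)) (cong f (sucMod-fromℕ p)) ⟩
    ∑ᴹ (f ∘ suc) ∙ f zero                                ≈⟨ comm _ _ ⟩
    ∑ᴹ f                                                 ∎

∑-rotate : ∀ {p} (f : Fin (suc p) → ℕ) → ∑ (f ∘ sucMod) ≡ ∑ f
∑-rotate = sum-rotate +-0-commutativeMonoid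

-- Summing the sides u_i u_{i+1}, u_{i+1} v_{i+1}, v_i v_{i+1}, u_i v_i of all
-- squares of the prism counts each outer and inner edge once, each spoke twice.
∑-squares : ∀ {p} (a b c : Fin (suc p) → ℕ) →
            ∑ (λ i → a i + (c (sucMod i) + (b i + (c i + 0)))) ≡ ∑ a + (∑ c + (∑ b + (∑ c + 0)))
∑-squares {p} a b c = begin
  ∑ (λ i → a i + (c (sucMod i) + (b i + (c i + 0))))
    ≡⟨ ℕ-Sum.∑-distrib-+ a (λ i → c (sucMod i) + (b i + (c i + 0))) ⟩
  ∑ a + ∑ (λ i → c (sucMod i) + (b i + (c i + 0)))
    ≡⟨ cong (∑ a +_) (ℕ-Sum.∑-distrib-+ (c ∘ sucMod) (λ i → b i + (c i + 0))) ⟩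
  ∑ a + (∑ (c ∘ sucMod) + ∑ (λ i → b i + (c i + 0)))
    ≡⟨ cong (λ x → ∑ a + (x + ∑ (λ i → b i + (c i + 0)))) (∑-rotate c) ⟩
  ∑ a + (∑ c + ∑ (λ i → b i + (c i + 0)))
    ≡⟨ cong (λ x → ∑ a + (∑ c + x)) (ℕ-Sum.∑-distrib-+ b (λ i → c i + 0)) ⟩
  ∑ a + (∑ c + (∑ b + ∑ (λ i → c i + 0)))
    ≡⟨ cong (λ x → ∑ a + (∑ c + (∑ b + x))) (ℕ-Sum.∑-distrib-+ c (λ _ → 0)) ⟩
  ∑ a + (∑ c + (∑ b + (∑ c + ∑ {suc p} (λ _ → 0))))
    ≡⟨ cong (λ x → ∑ a + (∑ c + (∑ b + (∑ c + x)))) (ℕ-Sum.sum-replicate-zero (suc p)) ⟩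
  ∑ a + (∑ c + (∑ b + (∑ c + 0)))                    ∎
  where open ≡-Reasoning

parity-coboundary : ∀ {p} (g : Fin (suc p) → Bool) → parity (λ i → g i xor g (sucMod i)) ≡ false
parity-coboundary g = begin
  parity (λ i → g i xor g (sucMod i)) ≡⟨ ⊕-Sum.∑-distrib-+ g (g ∘ sucMod) ⟩
  parity g xor parity (g ∘ sucMod)    ≡⟨ cong (parity g xor_) (sum-rotate ⊕-commutativeMonoid g) ⟩
  parity g xor parity g               ≡⟨ xor-same (parity g) ⟩
  false                               ∎
  where open ≡-Reasoning

signs : {G : Graph} → Subset (E G) → (c : Cycle G) → Fin (3 + k c) → Bool
signs Eₘ c j = lookup Eₘ (edge c j)

negCount-mod-2 : {G : Graph} (Eₘ : Subset (E G)) (c : Cycle G) →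
                 negCount Eₘ c % 2 ≡ bit (parity (signs Eₘ c))
negCount-mod-2 Eₘ c = begin
  negCount Eₘ c % 2                ≡⟨ cong (_% 2) (cong sum (map-tabulate (λ j → j) (bit ∘ signs Eₘ c))) ⟩
  sum (tabulate (bit ∘ signs Eₘ c)) % 2 ≡⟨ cong (_% 2) (sum-tabulate (bit ∘ signs Eₘ c)) ⟩
  ∑ (bit ∘ signs Eₘ c) % 2         ≡⟨ ∑bit-mod-2 (signs Eₘ c) ⟩
  bit (parity (signs Eₘ c))        ∎
  where open ≡-Reasoning

even⇒positive : {G : Graph} (Eₘ : Subset (E G)) (c : Cycle G) →
                parity (signs Eₘ c) ≡ false → Positive Eₘ c
even⇒positive Eₘ c even = trans (negCount-mod-2 Eₘ c) (cong bit even)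

odd⇒¬positive : {G : Graph} (Eₘ : Subset (E G)) (c : Cycle G) →
                parity (signs Eₘ c) ≡ true → ¬ Positive Eₘ c
odd⇒¬positive Eₘ c odd positive =
  contradiction (trans (sym (trans (negCount-mod-2 Eₘ c) (cong bit odd))) positive) λ ()

-- Switching at the vertices where s is true changes the sign of every edge
-- with exactly one switched endpoint; an edge is frustrated if its sign
-- after switching is negative.  frustration-at takes the endpoints apart.
frustration-at : (G : Graph) → Subset (E G) → (Fin (V G) → Bool) → Fin (E G) → Fin (V G) × Fin (V G) → Bool
frustration-at G Eₘ s e (a , b) = lookup Eₘ e xor (s a xor s b)

frustration : (G : Graph) → Subset (E G) → (Fin (V G) → Bool) → Fin (E G) → Bool
frustration G Eₘ s e = frustration-at G Eₘ s e (ends G e)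

frustration-joins : (G : Graph) (Eₘ : Subset (E G)) (s : Fin (V G) → Bool) {e : Fin (E G)} {a b : Fin (V G)} →
                    Joins G e a b → frustration G Eₘ s e ≡ lookup Eₘ e xor (s a xor s b)
frustration-joins G Eₘ s {e} (inj₁ ends≡ab) = cong (frustration-at G Eₘ s e) ends≡ab
frustration-joins G Eₘ s {e} {a} {b} (inj₂ ends≡ba) =
  trans (cong (frustration-at G Eₘ s e) ends≡ba) (cong (lookup Eₘ e xor_) (xor-comm (s b) (s a)))

-- If no undeleted edge is frustrated, every surviving cycle is positive:
-- its signs are the differences of the switching around the cycle.
switching-balances : (G : Graph) (Eₘ D : Subset (E G)) (s : Fin (V G) → Bool) →
                     (∀ e → e ∉ D → frustration G Eₘ s e ≡ false) → BalancedAfterDeleting G Eₘ D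
switching-balances G Eₘ D s unfrustrated c avoids = even⇒positive Eₘ c (begin
  parity (signs Eₘ c)                 ≡⟨ ⊕-Sum.sum-cong-≗ sign≡difference ⟩
  parity (λ j → g j xor g (sucMod j)) ≡⟨ parity-coboundary g ⟩
  false                               ∎)
  where
  open ≡-Reasoning
  g : Fin (3 + k c) → Bool
  g = s ∘ vert c
  sign≡difference : ∀ j → signs Eₘ c j ≡ g j xor g (sucMod j)
  sign≡difference j = xor≡false⇒≡ _ _
    (trans (sym (frustration-joins G Eₘ s (joins c j))) (unfrustrated (edge c j) (avoids j)))

frustratedEdges : (G : Graph) → Subset (E G) → (Fin (V G) → Bool) → Subset (E G)
frustratedEdges G Eₘ s = Vec.tabulate (frustration G Eₘ s)

switchingCost : (G : Graph) → Subset (E G) → (Fin (V G) → Bool) → ℕ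
switchingCost G Eₘ s = ∑ (bit ∘ frustration G Eₘ s)

frustratedEdges-balance : (G : Graph) (Eₘ : Subset (E G)) (s : Fin (V G) → Bool) →
                          BalancedAfterDeleting G Eₘ (frustratedEdges G Eₘ s)
frustratedEdges-balance G Eₘ s = switching-balances G Eₘ _ s unfrustrated
  where
  unfrustrated : ∀ e → e ∉ frustratedEdges G Eₘ s → frustration G Eₘ s e ≡ false
  unfrustrated e e∉ with frustration G Eₘ s e in frustrated
  ... | false = refl
  ... | true = contradiction (lookup⇒[]= e _ (trans (lookup∘tabulate _ e) frustrated)) e∉

∣frustratedEdges∣ : (G : Graph) (Eₘ : Subset (E G)) (s : Fin (V G) → Bool) →
                    ∣ frustratedEdges G Eₘ s ∣ ≡ switchingCost G Eₘ s
∣frustratedEdges∣ G Eₘ s =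
  trans (∣∣≡∑ (frustratedEdges G Eₘ s)) (ℕ-Sum.sum-cong-≗ (cong bit ∘ lookup∘tabulate (frustration G Eₘ s)))

meets-negative-cycle : (G : Graph) (Eₘ D : Subset (E G)) → BalancedAfterDeleting G Eₘ D →
                       (c : Cycle G) → parity (signs Eₘ c) ≡ true → 1 ≤ ∑ (λ j → bit (lookup D (edge c j)))
meets-negative-cycle G Eₘ D balanced c negative =
  n≢0⇒n>0 λ none → odd⇒¬positive Eₘ c negative (balanced c (avoids none))
  where
  deleted : Fin (3 + k c) → ℕ
  deleted j = bit (lookup D (edge c j))
  avoids : ∑ deleted ≡ 0 → ∀ j → edge c j ∉ D
  avoids none j e∈D =
    contradiction (subst₂ _≤_ (cong bit ([]=⇒lookup e∈D)) none (term≤∑ deleted j)) λ ()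

maxFrustration-from-bounds : (G : Graph) (m : ℕ) (Eₘ : Subset (E G)) →
  (∀ D → BalancedAfterDeleting G Eₘ D → m ≤ ∣ D ∣) →
  (∀ Eₘ′ → Σ (Subset (E G)) λ D → ∣ D ∣ ≤ m × BalancedAfterDeleting G Eₘ′ D) →
  IsMaxFrustration G m
maxFrustration-from-bounds G m Eₘ lower upper = (Eₘ , index) , maximal
  where
  index : IsFrustrationIndex G Eₘ m
  index with upper Eₘ
  ... | D , small , balanced = (D , ≤-antisym small (lower D balanced) , balanced) , lower
  maximal : ∀ Eₘ′ l → IsFrustrationIndex G Eₘ′ l → l ≤ m
  maximal Eₘ′ l (_ , minimal) with upper Eₘ′
  ... | D , small , balanced = ≤-trans (minimal D balanced) small

cycleCost : ∀ {p} → (Fin (suc p) → Bool) → (Fin (suc p) → Bool) → ℕ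
cycleCost τ x = ∑ (λ i → bit (τ i xor (x i xor x (sucMod i))))

prefix : ∀ {m} → (Fin m → Bool) → Fin (suc m) → Bool
prefix f zero = false
prefix {suc m} f (suc i) = f zero xor prefix (f ∘ suc) i

prefix-suc : ∀ {m} (f : Fin m → Bool) (j : Fin m) → prefix f (suc j) ≡ prefix f (inject₁ j) xor f j
prefix-suc f zero = xor-identityʳ (f zero)
prefix-suc f (suc j) = trans (cong (f zero xor_) (prefix-suc (f ∘ suc) j)) (sym (xor-assoc (f zero) _ _))

prefix-fromℕ : ∀ m (f : Fin m → Bool) → prefix f (fromℕ m) ≡ parity f
prefix-fromℕ zero f = refl
prefix-fromℕ (suc m) f = cong (f zero xor_) (prefix-fromℕ m (f ∘ suc))

<ᵇ-step : ∀ r x → (r <ᵇ x) xor (r <ᵇ suc x) ≡ (x ≡ᵇ r)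
<ᵇ-step zero zero = refl
<ᵇ-step (suc r) zero = refl
<ᵇ-step zero (suc x) = refl
<ᵇ-step (suc r) (suc x) = <ᵇ-step r x

∑-indicator : ∀ p r → ∑ {p} (λ j → bit (toℕ j ≡ᵇ r)) ≡ bit (r <ᵇ p)
∑-indicator zero r = refl
∑-indicator (suc p) zero = cong suc (ℕ-Sum.sum-replicate-zero p)
∑-indicator (suc p) (suc r) = ∑-indicator p r

-- The cut switching of a cycle with signs τ: switch by the prefix parities
-- of τ, which makes all edges but the closing one positive, and further
-- switch every vertex beyond position r, which makes edge r negative.
cut : ∀ {p} → (Fin (suc p) → Bool) → ℕ → Fin (suc p) → Bool
cut τ r i = prefix (τ ∘ inject₁) i xor (r <ᵇ toℕ i)

-- Its cost: edge r (if r < p) and the closing edge (if the resulting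
-- closing sign is negative).
cut-cost : ∀ {p} (τ : Fin (suc p) → Bool) (r : ℕ) →
           cycleCost τ (cut τ r) ≡ bit (r <ᵇ p) + bit (parity τ xor (r <ᵇ p))
cut-cost {p} τ r = begin
  cycleCost τ (cut τ r)                                    ≡⟨ ℕ-Sum.sum-init-last (bit ∘ frustrated) ⟩
  ∑ (bit ∘ frustrated ∘ inject₁) + bit (frustrated (fromℕ p))
    ≡⟨ cong₂ _+_ (ℕ-Sum.sum-cong-≗ {p} (cong bit ∘ interior)) (cong bit closing) ⟩
  ∑ {p} (λ j → bit (toℕ j ≡ᵇ r)) + bit (parity τ xor (r <ᵇ p))
    ≡⟨ cong (_+ bit (parity τ xor (r <ᵇ p))) (∑-indicator p r) ⟩
  bit (r <ᵇ p) + bit (parity τ xor (r <ᵇ p))               ∎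
  where
  open ≡-Reasoning
  τ′ : Fin p → Bool
  τ′ = τ ∘ inject₁
  frustrated : Fin (suc p) → Bool
  frustrated i = τ i xor (cut τ r i xor cut τ r (sucMod i))
  telescope : ∀ t P a b → t xor ((P xor a) xor ((P xor t) xor b)) ≡ a xor b
  telescope = solve-∀ ⊕-ring
  interior : ∀ j → frustrated (inject₁ j) ≡ (toℕ j ≡ᵇ r)
  interior j = begin
    τ′ j xor (cut τ r (inject₁ j) xor cut τ r (sucMod (inject₁ j)))
      ≡⟨ cong (λ i → τ′ j xor (cut τ r (inject₁ j) xor cut τ r i)) (sucMod-inject₁ j) ⟩
    τ′ j xor ((prefix τ′ (inject₁ j) xor (r <ᵇ toℕ (inject₁ j))) xor (prefix τ′ (suc j) xor (r <ᵇ suc (toℕ j))))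
      ≡⟨ cong₂ (λ a b → τ′ j xor ((prefix τ′ (inject₁ j) xor (r <ᵇ a)) xor (b xor (r <ᵇ suc (toℕ j)))))
               (toℕ-inject₁ j) (prefix-suc τ′ j) ⟩
    τ′ j xor ((prefix τ′ (inject₁ j) xor (r <ᵇ toℕ j)) xor ((prefix τ′ (inject₁ j) xor τ′ j) xor (r <ᵇ suc (toℕ j))))
      ≡⟨ telescope (τ′ j) (prefix τ′ (inject₁ j)) (r <ᵇ toℕ j) (r <ᵇ suc (toℕ j)) ⟩
    (r <ᵇ toℕ j) xor (r <ᵇ suc (toℕ j))                 ≡⟨ <ᵇ-step r (toℕ j) ⟩
    (toℕ j ≡ᵇ r)                                         ∎
  wrap : ∀ t Q a → t xor ((Q xor a) xor false) ≡ (Q xor t) xor a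
  wrap = solve-∀ ⊕-ring
  closing : frustrated (fromℕ p) ≡ parity τ xor (r <ᵇ p)
  closing = begin
    τ (fromℕ p) xor (cut τ r (fromℕ p) xor cut τ r (sucMod (fromℕ p)))
      ≡⟨ cong (λ i → τ (fromℕ p) xor (cut τ r (fromℕ p) xor cut τ r i)) (sucMod-fromℕ p) ⟩
    τ (fromℕ p) xor ((prefix τ′ (fromℕ p) xor (r <ᵇ toℕ (fromℕ p))) xor false)
      ≡⟨ cong₂ (λ a b → τ (fromℕ p) xor ((a xor (r <ᵇ b)) xor false)) (prefix-fromℕ p τ′) (toℕ-fromℕ p) ⟩
    τ (fromℕ p) xor ((parity τ′ xor (r <ᵇ p)) xor false) ≡⟨ wrap (τ (fromℕ p)) (parity τ′) (r <ᵇ p) ⟩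
    (parity τ′ xor τ (fromℕ p)) xor (r <ᵇ p)              ≡⟨ cong (_xor (r <ᵇ p)) (⊕-Sum.sum-init-last τ) ⟨
    parity τ xor (r <ᵇ p)                                 ∎

cycleCost-complement : ∀ {p} (τ x : Fin (suc p) → Bool) (c : Bool) → cycleCost τ (λ i → c xor x i) ≡ cycleCost τ x
cycleCost-complement τ x c = ℕ-Sum.sum-cong-≗ λ i → cong bit (cancel (τ i) c (x i) (x (sucMod i)))
  where
  cancel : ∀ t c a b → t xor ((c xor a) xor (c xor b)) ≡ t xor (a xor b)
  cancel = solve-∀ ⊕-ring

<ᵇ-false : ∀ {m n} → m ≤ n → (n <ᵇ m) ≡ false
<ᵇ-false z≤n = refl
<ᵇ-false (s≤s m≤n) = <ᵇ-false m≤n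

<ᵇ-shift : ∀ r x → (r <ᵇ x) xor (suc r <ᵇ x) ≡ (x ≡ᵇ suc r)
<ᵇ-shift r zero = refl
<ᵇ-shift zero (suc zero) = refl
<ᵇ-shift zero (suc (suc x)) = refl
<ᵇ-shift (suc r) (suc x) = <ᵇ-shift r x

isolate : ∀ {p} (c : Bool) (m : Fin (suc p)) → Σ Bool λ c′ → Σ ℕ λ r → Σ ℕ λ r′ →
          ∀ (i : Fin (suc p)) → c′ xor ((r <ᵇ toℕ i) xor (r′ <ᵇ toℕ i)) ≡ c xor (toℕ i ≡ᵇ toℕ m)
isolate {p} c zero = not c , 0 , p , λ i →
  trans (cong (λ b → not c xor ((0 <ᵇ toℕ i) xor b)) (<ᵇ-false (≤-pred (toℕ<n i)))) (at-zero c (toℕ i))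
  where
  at-zero : ∀ c x → not c xor ((0 <ᵇ x) xor false) ≡ c xor (x ≡ᵇ 0)
  at-zero false zero = refl
  at-zero true zero = refl
  at-zero false (suc x) = refl
  at-zero true (suc x) = refl
isolate c (suc m) = c , toℕ m , suc (toℕ m) , λ i → cong (c xor_) (<ᵇ-shift (toℕ m) (toℕ i))

bit≤1 : ∀ b → bit b ≤ 1
bit≤1 false = z≤n
bit≤1 true = s≤s z≤n

-- On a negative cycle every cut costs exactly one edge.
cut-cost-negative : ∀ {b} → b ≡ true → ∀ a → bit a + bit (b xor a) ≡ 1
cut-cost-negative refl false = refl
cut-cost-negative refl true = refl

half-of : ∀ {m} x → x + x ≤ m → x ≤ m / 2
half-of {m} x le = subst (_≤ m / 2) (m*n/n≡m x 2) (/-monoˡ-≤ 2 (subst (_≤ m) (double x) le))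
  where
  double : ∀ x → x + x ≡ x * 2
  double = ℕ-Solver.solve-∀

halving : ∀ a b → a ≤ (a + b) / 2 ⊎ b ≤ (a + b) / 2
halving a b with ≤-total a b
... | inj₁ a≤b = inj₁ (half-of a (+-monoʳ-≤ a a≤b))
... | inj₂ b≤a = inj₂ (half-of b (+-monoˡ-≤ b b≤a))

prismEdge : ∀ {n} → Fin 3 → Fin n → Fin (E (Prism n))
prismEdge r i = combine r i

prismEdge-ends : ∀ {n} (r : Fin 3) (i : Fin n) → ends (Prism n) (prismEdge r i) ≡ prismEnds (r , i)
prismEdge-ends r i = cong prismEnds (remQuot-combine r i)

prismSign : ∀ {n} → Subset (E (Prism n)) → Fin 3 → Fin n → Bool
prismSign Eₘ r i = lookup Eₘ (prismEdge r i)

prismSwitch : ∀ {n} → (Fin n → Bool) → (Fin n → Bool) → Fin (n + n) → Bool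
prismSwitch {n} x y w = [ x , y ]′ (splitAt n w)

prismCost : ∀ {p} (Eₘ : Subset (E (Prism (suc p)))) (x y : Fin (suc p) → Bool) →
            switchingCost (Prism (suc p)) Eₘ (prismSwitch x y)
              ≡ cycleCost (prismSign Eₘ 0F) x + (cycleCost (prismSign Eₘ 1F) y
                  + (∑ (λ i → bit (prismSign Eₘ 2F i xor (x i xor y i))) + 0))
prismCost {p} Eₘ x y = trans (∑-combine 3 n (bit ∘ frustration (Prism n) Eₘ s))
  (cong₂ _+_ (ℕ-Sum.sum-cong-≗ (cong bit ∘ outer))
    (cong₂ _+_ (ℕ-Sum.sum-cong-≗ (cong bit ∘ inner)) (cong (_+ 0) (ℕ-Sum.sum-cong-≗ (cong bit ∘ spoke)))))
  where
  n : ℕ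
  n = suc p
  s : Fin (n + n) → Bool
  s = prismSwitch x y
  at : ∀ (r : Fin 3) (i : Fin n) → frustration (Prism n) Eₘ s (prismEdge r i)
                                   ≡ frustration-at (Prism n) Eₘ s (prismEdge r i) (prismEnds (r , i))
  at r i = cong (frustration-at (Prism n) Eₘ s (prismEdge r i)) (prismEdge-ends r i)
  s-outer : ∀ i → s (uV i) ≡ x i
  s-outer i = cong [ x , y ]′ (splitAt-↑ˡ n i n)
  s-inner : ∀ i → s (vV i) ≡ y i
  s-inner i = cong [ x , y ]′ (splitAt-↑ʳ n n i)
  outer : ∀ i → frustration (Prism n) Eₘ s (prismEdge 0F i) ≡ prismSign Eₘ 0F i xor (x i xor x (sucMod i))
  outer i = trans (at 0F i) (cong₂ (λ a b → prismSign Eₘ 0F i xor (a xor b)) (s-outer i) (s-outer (sucMod i)))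
  inner : ∀ i → frustration (Prism n) Eₘ s (prismEdge 1F i) ≡ prismSign Eₘ 1F i xor (y i xor y (sucMod i))
  inner i = trans (at 1F i) (cong₂ (λ a b → prismSign Eₘ 1F i xor (a xor b)) (s-inner i) (s-inner (sucMod i)))
  spoke : ∀ i → frustration (Prism n) Eₘ s (prismEdge 2F i) ≡ prismSign Eₘ 2F i xor (x i xor y i)
  spoke i = trans (at 2F i) (cong₂ (λ a b → prismSign Eₘ 2F i xor (a xor b)) (s-outer i) (s-inner i))

spoke-regroup : ∀ s P a c Q b → s xor ((P xor a) xor (c xor (Q xor b))) ≡ (c xor (s xor (P xor Q))) xor (a xor b)
spoke-regroup = solve-∀ ⊕-ring

xor-swap : ∀ a b c → (a xor b) xor c ≡ (a xor c) xor b
xor-swap = solve-∀ ⊕-ring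

-- The arithmetic behind the uncut switching: two cycle terms and S ≤ h
-- negative spokes, where not all of them can be present.
uncut-arith : ∀ a b {S h} → 1 ≤ h → S ≤ h → a ≡ false ⊎ b ≡ false ⊎ S ≡ 0 → bit a + (bit b + S) ≤ suc h
uncut-arith false b 1≤h few _ = +-mono-≤ (bit≤1 b) few
uncut-arith true false 1≤h few _ = s≤s few
uncut-arith true true 1≤h few (inj₂ (inj₂ refl)) = s≤s 1≤h

module UpperBound {p : ℕ} (Eₘ : Subset (E (Prism (suc p)))) where

  σ : Fin 3 → Fin (suc p) → Bool
  σ = prismSign Eₘ

  outerNegative innerNegative : Bool
  outerNegative = parity (σ 0F)
  innerNegative = parity (σ 1F)

  -- Spoke signs after switching both cycles by the prefix parities.
  t : Fin (suc p) → Bool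
  t i = σ 2F i xor (prefix (σ 0F ∘ inject₁) i xor prefix (σ 1F ∘ inject₁) i)

  -- The number of negative spokes when the inner cycle is also complemented by c.
  spokeCount : Bool → ℕ
  spokeCount c = ∑ (λ i → bit (c xor t i))

  cost : (Fin (suc p + suc p) → Bool) → ℕ
  cost = switchingCost (Prism (suc p)) Eₘ

  switch : Bool → ℕ → ℕ → Fin (suc p + suc p) → Bool
  switch c r r′ = prismSwitch (cut (σ 0F) r) (λ i → c xor cut (σ 1F) r′ i)

  switch-cost : ∀ c r r′ → cost (switch c r r′)
                  ≡ (bit (r <ᵇ p) + bit (outerNegative xor (r <ᵇ p)))
                    + ((bit (r′ <ᵇ p) + bit (innerNegative xor (r′ <ᵇ p)))
                      + (∑ (λ i → bit ((c xor t i) xor ((r <ᵇ toℕ i) xor (r′ <ᵇ toℕ i)))) + 0))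
  switch-cost c r r′ = trans (prismCost Eₘ (cut (σ 0F) r) (λ i → c xor cut (σ 1F) r′ i))
    (cong₂ _+_ (cut-cost (σ 0F) r)
      (cong₂ _+_ (trans (cycleCost-complement (σ 1F) (cut (σ 1F) r′) c) (cut-cost (σ 1F) r′))
        (cong (_+ 0) (ℕ-Sum.sum-cong-≗ λ i → cong bit (spoke-regroup (σ 2F i) (prefix (σ 0F ∘ inject₁) i) (r <ᵇ toℕ i) c
                                                                      (prefix (σ 1F ∘ inject₁) i) (r′ <ᵇ toℕ i))))))

  uncut-cost : ∀ c → cost (switch c p p) ≡ bit outerNegative + (bit innerNegative + spokeCount c)
  uncut-cost c = trans (switch-cost c p p)
    (cong₂ _+_ (uncut outerNegative) (cong₂ _+_ (uncut innerNegative)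
      (trans (+-identityʳ _) (ℕ-Sum.sum-cong-≗ (cong bit ∘ uncut-spoke)))))
    where
    uncut-spoke : ∀ i → (c xor t i) xor ((p <ᵇ toℕ i) xor (p <ᵇ toℕ i)) ≡ c xor t i
    uncut-spoke i = trans (cong ((c xor t i) xor_) (xor-same (p <ᵇ toℕ i))) (xor-identityʳ (c xor t i))
    uncut : ∀ b → bit (p <ᵇ p) + bit (b xor (p <ᵇ p)) ≡ bit b
    uncut b rewrite <ᵇ-false (≤-refl {p}) = cong bit (xor-identityʳ b)

  negative-cost : outerNegative ≡ true → innerNegative ≡ true → ∀ c r r′ →
                  cost (switch c r r′) ≡ 1 + (1 + ∑ (λ i → bit ((c xor t i) xor ((r <ᵇ toℕ i) xor (r′ <ᵇ toℕ i)))))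
  negative-cost outer inner c r r′ = trans (switch-cost c r r′)
    (cong₂ _+_ (cut-cost-negative outer (r <ᵇ p)) (cong₂ _+_ (cut-cost-negative inner (r′ <ᵇ p)) (+-identityʳ _)))

  cheapSide : Σ Bool λ c → spokeCount c ≤ suc p / 2
  cheapSide with halving (spokeCount false) (spokeCount true)
  ... | inj₁ few = false , subst (λ m → spokeCount false ≤ m / 2) (∑bit-complement t) few
  ... | inj₂ few = true , subst (λ m → spokeCount true ≤ m / 2) (∑bit-complement t) few

  uncut-bound : ∀ c → 1 ≤ suc p / 2 → spokeCount c ≤ suc p / 2 →
                outerNegative ≡ false ⊎ innerNegative ≡ false ⊎ spokeCount c ≡ 0 →
                cost (switch c p p) ≤ suc (suc p / 2)
  uncut-bound c 1≤h few cheap =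
    subst (_≤ suc (suc p / 2)) (sym (uncut-cost c)) (uncut-arith outerNegative innerNegative 1≤h few cheap)

  -- If both cycles are negative, a negative spoke m can be made positive,
  -- saving one edge, by cutting the two cycles on either side of it.
  isolated-bound : outerNegative ≡ true → innerNegative ≡ true → ∀ c (m : Fin (suc p)) →
                   c xor t m ≡ true → spokeCount c ≤ suc p / 2 →
                   ∃ λ s → cost s ≤ suc (suc p / 2)
  isolated-bound outer inner c m negative few with isolate c m
  ... | c′ , r , r′ , flips = switch c′ r r′ , (begin
    cost (switch c′ r r′)
      ≡⟨ negative-cost outer inner c′ r r′ ⟩
    2 + ∑ (λ i → bit ((c′ xor t i) xor ((r <ᵇ toℕ i) xor (r′ <ᵇ toℕ i))))
      ≡⟨ cong (2 +_) (ℕ-Sum.sum-cong-≗ (cong bit ∘ flipped)) ⟩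
    2 + ∑ (λ i → bit ((c xor t i) xor (toℕ i ≡ᵇ toℕ m)))
      ≡⟨ cong suc (+-comm 1 _) ⟩
    suc (∑ (λ i → bit ((c xor t i) xor (toℕ i ≡ᵇ toℕ m))) + 1)
      ≡⟨ cong suc (∑bit-flip (λ i → c xor t i) m negative) ⟩
    suc (spokeCount c)
      ≤⟨ s≤s few ⟩
    suc (suc p / 2) ∎)
    where
    open ≤-Reasoning
    flipped : ∀ i → (c′ xor t i) xor ((r <ᵇ toℕ i) xor (r′ <ᵇ toℕ i)) ≡ (c xor t i) xor (toℕ i ≡ᵇ toℕ m)
    flipped i = trans (xor-swap c′ (t i) _) (trans (cong (_xor t i) (flips i)) (sym (xor-swap c (t i) _)))

  upperBound : 1 ≤ p → ∃ λ s → cost s ≤ suc p / 2 + 1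
  upperBound 1≤p with cheapSide
  ... | c , few = map₂ (λ le → ≤-trans le (≤-reflexive (+-comm 1 (suc p / 2)))) (bound c few)
    where
    1≤h : 1 ≤ suc p / 2
    1≤h = /-monoˡ-≤ 2 (s≤s 1≤p)
    bound : ∀ c → spokeCount c ≤ suc p / 2 → ∃ λ s → cost s ≤ suc (suc p / 2)
    bound c few with outerNegative in outer | innerNegative in inner | any? (λ m → (c xor t m) ≟ true)
    ... | true | true | yes (m , negative) = isolated-bound outer inner c m negative few
    ... | true | true | no none = switch c p p , uncut-bound c 1≤h few (inj₂ (inj₂ (∑bit-none _ none)))
    ... | true | false | _ = switch c p p , uncut-bound c 1≤h few (inj₂ (inj₁ inner))
    ... | false | _ | _ = switch c p p , uncut-bound c 1≤h few (inj₁ outer)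

  balancingSet : 1 ≤ p → Σ (Subset (E (Prism (suc p)))) λ D →
                 ∣ D ∣ ≤ suc p / 2 + 1 × BalancedAfterDeleting (Prism (suc p)) Eₘ D
  balancingSet 1≤p with upperBound 1≤p
  ... | s , cheap = frustratedEdges (Prism (suc p)) Eₘ s
                  , subst (_≤ suc p / 2 + 1) (sym (∣frustratedEdges∣ (Prism (suc p)) Eₘ s)) cheap
                  , frustratedEdges-balance (Prism (suc p)) Eₘ s

distinct4⇒injective : ∀ {A : Set} (w : Fin 4 → A) →
                      w 0F ≢ w 1F → w 0F ≢ w 2F → w 0F ≢ w 3F → w 1F ≢ w 2F → w 1F ≢ w 3F → w 2F ≢ w 3F →
                      Injective _≡_ _≡_ w
distinct4⇒injective w d01 d02 d03 d12 d13 d23 = injective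
  where
  injective : Injective _≡_ _≡_ w
  injective {0F} {0F} _ = refl
  injective {0F} {1F} eq = contradiction eq d01
  injective {0F} {2F} eq = contradiction eq d02
  injective {0F} {3F} eq = contradiction eq d03
  injective {1F} {0F} eq = contradiction (sym eq) d01
  injective {1F} {1F} _ = refl
  injective {1F} {2F} eq = contradiction eq d12
  injective {1F} {3F} eq = contradiction eq d13
  injective {2F} {0F} eq = contradiction (sym eq) d02
  injective {2F} {1F} eq = contradiction (sym eq) d12
  injective {2F} {2F} _ = refl
  injective {2F} {3F} eq = contradiction eq d23
  injective {3F} {0F} eq = contradiction (sym eq) d03
  injective {3F} {1F} eq = contradiction (sym eq) d13
  injective {3F} {2F} eq = contradiction (sym eq) d23
  injective {3F} {3F} _ = refl

uV≢vV : ∀ {n} (i j : Fin n) → uV i ≢ vV j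
uV≢vV {n} i j eq = <⇒≢ (≤-trans (toℕ<n i) (m≤m+n n (toℕ j)))
  (trans (sym (toℕ-↑ˡ i n)) (trans (cong toℕ eq) (toℕ-↑ʳ n j)))

-- Counting argument of the lower bound: the n squares force
-- a + 2c + b ≥ n, the outer cycle forces a ≥ 1 and, for even n, the inner
-- cycle forces b ≥ 1; hence a + b + c ≥ ⌊n/2⌋ + 1.
lower-arith : ∀ n a b c → n ≤ a + (c + (b + (c + 0))) → 1 ≤ a → (n % 2 ≡ 0 → 1 ≤ b) →
              n / 2 + 1 ≤ a + (b + (c + 0))
lower-arith n a b c squares outer inner = *-cancelʳ-≤ (n / 2 + 1) (a + (b + (c + 0))) 2 (begin
  (n / 2 + 1) * 2                   ≡⟨ double-succ (n / 2) ⟩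
  n / 2 * 2 + 2                     ≤⟨ parity-step ⟩
  n + (a + b)                       ≤⟨ +-monoˡ-≤ (a + b) squares ⟩
  a + (c + (b + (c + 0))) + (a + b) ≡⟨ twice a b c ⟩
  (a + (b + (c + 0))) * 2           ∎)
  where
  open ≤-Reasoning
  double-succ : ∀ h → (h + 1) * 2 ≡ h * 2 + 2
  double-succ = ℕ-Solver.solve-∀
  twice : ∀ a b c → a + (c + (b + (c + 0))) + (a + b) ≡ (a + (b + (c + 0))) * 2
  twice = ℕ-Solver.solve-∀
  parity-step : n / 2 * 2 + 2 ≤ n + (a + b)
  parity-step with n % 2 | m≡m%n+[m/n]*n n 2 | m%n<n n 2
  ... | 0 | even | _ = subst (λ m → m + 2 ≤ n + (a + b)) even (+-monoʳ-≤ n (+-mono-≤ outer (inner refl)))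
  ... | 1 | odd | _ = subst (_≤ n + (a + b)) (trans (cong (_+ 1) odd) (sym (+-suc (n / 2 * 2) 1)))
                        (+-monoʳ-≤ n (≤-trans outer (m≤m+n a b)))
  ... | suc (suc _) | _ | s≤s (s≤s ())

module LowerBound (k : ℕ) where

  n : ℕ
  n = 3 + k

  G : Graph
  G = Prism n

  outerCycle innerCycle : Cycle G
  outerCycle = record { k = k ; vert = uV ; edge = prismEdge 0F
                      ; vinj = λ {i} {j} → ↑ˡ-injective n i j ; joins = λ i → inj₁ (prismEdge-ends 0F i) }
  innerCycle = record { k = k ; vert = vV ; edge = prismEdge 1F
                      ; vinj = λ {i} {j} → ↑ʳ-injective n i j ; joins = λ i → inj₁ (prismEdge-ends 1F i) }

  square : Fin n → Cycle G
  square i = record { k = 1 ; vert = corner ; edge = side ; vinj = corner-injective ; joins = side-joins }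
    where
    i⁺ : Fin n
    i⁺ = sucMod i
    corner : Fin 4 → Fin (V G)
    corner 0F = uV i
    corner 1F = uV i⁺
    corner 2F = vV i⁺
    corner 3F = vV i
    side : Fin 4 → Fin (E G)
    side 0F = prismEdge 0F i
    side 1F = prismEdge 2F i⁺
    side 2F = prismEdge 1F i
    side 3F = prismEdge 2F i
    i⁺≢i : i⁺ ≢ i
    i⁺≢i = sucMod-≢ (s≤s z≤n) i
    corner-injective : Injective _≡_ _≡_ corner
    corner-injective = distinct4⇒injective corner
      (λ eq → i⁺≢i (sym (↑ˡ-injective n i i⁺ eq))) (uV≢vV i i⁺) (uV≢vV i i)
      (uV≢vV i⁺ i⁺) (uV≢vV i⁺ i) (λ eq → i⁺≢i (↑ʳ-injective n i⁺ i eq))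
    side-joins : ∀ j → Joins G (side j) (corner j) (corner (nextC j))
    side-joins 0F = inj₁ (prismEdge-ends 0F i)
    side-joins 1F = inj₁ (prismEdge-ends 2F i⁺)
    side-joins 2F = inj₂ (prismEdge-ends 1F i)
    side-joins 3F = inj₂ (prismEdge-ends 2F i)

  lowerBound : (Eₘ : Subset (E G)) →
               (∀ i → parity (signs Eₘ (square i)) ≡ true) → parity (signs Eₘ outerCycle) ≡ true →
               (n % 2 ≡ 0 → parity (signs Eₘ innerCycle) ≡ true) →
               ∀ D → BalancedAfterDeleting G Eₘ D → n / 2 + 1 ≤ ∣ D ∣
  lowerBound Eₘ squares outer inner D balanced = subst (n / 2 + 1 ≤_) (sym ∣D∣≡)
    (lower-arith n (∑ (d 0F)) (∑ (d 1F)) (∑ (d 2F)) squares-hit (hits outerCycle outer) (hits innerCycle ∘ inner))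
    where
    open ≤-Reasoning
    hits : (c : Cycle G) → parity (signs Eₘ c) ≡ true → 1 ≤ ∑ (λ j → bit (lookup D (edge c j)))
    hits = meets-negative-cycle G Eₘ D balanced
    d : Fin 3 → Fin n → ℕ
    d r i = bit (lookup D (prismEdge r i))
    ∣D∣≡ : ∣ D ∣ ≡ ∑ (d 0F) + (∑ (d 1F) + (∑ (d 2F) + 0))
    ∣D∣≡ = trans (∣∣≡∑ D) (∑-combine 3 n (bit ∘ lookup D))
    squares-hit : n ≤ ∑ (d 0F) + (∑ (d 2F) + (∑ (d 1F) + (∑ (d 2F) + 0)))
    squares-hit = begin
      n                                                               ≡⟨ ∑-ones n ⟨
      ∑ {n} (λ _ → 1)                                                 ≤⟨ ∑-mono (λ i → hits (square i) (squares i)) ⟩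
      ∑ (λ i → d 0F i + (d 2F (sucMod i) + (d 1F i + (d 2F i + 0)))) ≡⟨ ∑-squares (d 0F) (d 1F) (d 2F) ⟩
      ∑ (d 0F) + (∑ (d 2F) + (∑ (d 1F) + (∑ (d 2F) + 0)))             ∎

  hardSign : Fin 3 → Fin n → Bool
  hardSign 0F zero = true
  hardSign 0F (suc _) = false
  hardSign 1F zero = false
  hardSign 1F (suc _) = true
  hardSign 2F _ = false

  hardSignOf : Fin (E G) → Bool
  hardSignOf e = hardSign (proj₁ (remQuot {3} n e)) (proj₂ (remQuot {3} n e))

  hardSignature : Subset (E G)
  hardSignature = Vec.tabulate hardSignOf

  hardSignature-at : ∀ r i → prismSign hardSignature r i ≡ hardSign r i
  hardSignature-at r i = trans (lookup∘tabulate hardSignOf (prismEdge r i))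
    (cong (λ (ri : Fin 3 × Fin n) → hardSign (proj₁ ri) (proj₂ ri)) (remQuot-combine {3} {n} r i))

  -- Each square contains exactly one negative edge: u_0 u_1 or v_i v_{i+1}.
  hard-squares : ∀ i → parity (signs hardSignature (square i)) ≡ true
  hard-squares i = begin
    prismSign hardSignature 0F i xor (prismSign hardSignature 2F (sucMod i)
      xor (prismSign hardSignature 1F i xor (prismSign hardSignature 2F i xor false)))
      ≡⟨ cong₂ _xor_ (hardSignature-at 0F i) (cong₂ _xor_ (hardSignature-at 2F (sucMod i))
           (cong₂ _xor_ (hardSignature-at 1F i) (cong (_xor false) (hardSignature-at 2F i)))) ⟩
    hardSign 0F i xor (false xor (hardSign 1F i xor (false xor false)))
      ≡⟨ one-negative i ⟩
    true ∎
    where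
    open ≡-Reasoning
    one-negative : ∀ i → hardSign 0F i xor (false xor (hardSign 1F i xor (false xor false))) ≡ true
    one-negative zero = refl
    one-negative (suc _) = refl

  -- The outer cycle has the single negative edge u_0 u_1.
  hard-outer : parity (signs hardSignature outerCycle) ≡ true
  hard-outer = trans (⊕-Sum.sum-cong-≗ (hardSignature-at 0F)) (cong (true xor_) (⊕-Sum.sum-replicate-zero (2 + k)))

  -- The inner cycle has n - 1 negative edges, an odd number when n is even.
  hard-inner : n % 2 ≡ 0 → parity (signs hardSignature innerCycle) ≡ true
  hard-inner even = trans (⊕-Sum.sum-cong-≗ (hardSignature-at 1F)) (not-odd (trans (parity-ones n) even))
    where
    not-odd : ∀ {b} → bit (not b) ≡ 0 → b ≡ true
    not-odd {false} ()
    not-odd {true} _ = refl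

  hard-lower : ∀ D → BalancedAfterDeleting G hardSignature D → n / 2 + 1 ≤ ∣ D ∣
  hard-lower = lowerBound hardSignature hard-squares hard-outer hard-inner

theorem3p5 : (n : ℕ) → 3 ≤ n → IsMaxFrustration (Prism n) (n / 2 + 1)
theorem3p5 1 (s≤s ())
theorem3p5 2 (s≤s (s≤s ()))
theorem3p5 (suc (suc (suc k))) _ =
  maxFrustration-from-bounds _ _ hardSignature hard-lower
    (λ Eₘ → UpperBound.balancingSet Eₘ (s≤s z≤n))
  where open LowerBound k
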